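{- Let $n,k,\alpha$ be positive integers and let $p$ be a prime. Then \[ \binom{p^{\alpha}n-1}{k}\equiv \binom{p^{\alpha-1}n-1}{\lfloor k/p\rfloor}(-1)^{k-\lfloor k/p\rfloor}\Big(1-np^{\alpha}\sum_{\substack{j=1\\ p\nmid j}}^{k}\frac{1}{j}\Big)\pmod{p^{2\alpha}}. \]
   Context: The right-hand side is a rational number whose denominator is prime to $p$; the congruence is understood in the ring $\mathbb{Z}_p$ of $p$-adic integers. $\lfloor x\rfloor$ is the floor function. -}

module Defs where

open import Data.Nat as ℕ using (ℕ; zero; suc)
open import Data.Nat.Divisibility using (_∣_; _∣?_)
open import Data.Integer as ℤ using (ℤ; +_)
open import Data.Rational as ℚ using (ℚ; 0ℚ; _+_; _-_; _*_; ↧ₙ_)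
open import Data.Product using (∃; _×_)
open import Relation.Nullary using (¬_; yes; no)
open import Relation.Binary.PropositionalEquality using (_≡_)

ℕtoℚ : ℕ → ℚ
ℕtoℚ m = + m ℚ./ 1

-- A rational is a p-adic integer (lies in ℤ_(p) ⊆ ℤ_p) iff p does not
-- divide its (reduced) denominator.
IsPIntegral : ℕ → ℚ → Set
IsPIntegral p t = ¬ (p ∣ (↧ₙ t))

-- Congruence x ≡ y (mod p^m) in ℤ_p for rationals with p-integral values:
-- x - y = p^m * t for some p-integral rational t.
_≡_[mod_^_] : ℚ → ℚ → ℕ → ℕ → Set
x ≡ y [mod p ^ m ] = ∃ λ t → IsPIntegral p t × (x - y ≡ ℕtoℚ (p ℕ.^ m) * t)

harmonicPrimeTo : ℕ → ℕ → ℚ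
harmonicPrimeTo p zero = 0ℚ
harmonicPrimeTo p (suc j) with p ∣? suc j
... | yes _ = harmonicPrimeTo p j
... | no  _ = harmonicPrimeTo p j + (+ 1 ℚ./ suc j)

-- Write N = p^α n and M = N / p, and expand C(N - 1, k) = ∏_{j=1}^{k} (N - j) / j.
-- The factors with j = p i equal (M - i) / i and multiply to C(M - 1, ⌊k/p⌋). Each of the
-- k - ⌊k/p⌋ remaining factors is -(1 - N/j) with 1/j ∈ ℤ₍ₚ₎, so their product is
-- (-1)^(k - ⌊k/p⌋) (1 - N Σ 1/j) modulo N² ℤ₍ₚ₎, and p^(2α) divides N².
module Submission where

open import Defs
open import Data.Empty using (⊥-elim)
open import Data.Integer as ℤ using (ℤ; -1ℤ)
open import Data.Integer.GCD using () renaming (gcd to gcdℤ)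
import Data.Integer.Properties as ℤ
open import Data.Integer.Solver using () renaming (module +-*-Solver to ℤ-Solver)
open import Data.Nat as ℕ using (ℕ; zero; suc; _≤_; _∸_; _^_)
open import Data.Nat.Combinatorics using (_C_; nC1≡n; nCk+nC[k+1]≡[n+1]C[k+1])
open import Data.Nat.Divisibility using (_∣_; _∣?_; divides; ∣-trans; ∣1⇒≡1; n∣m⇒m%n≡0)
open import Data.Nat.DivMod
  using (_/_; _%_; m≡m%n+[m/n]*n; m%n<n; %-pred-≡0; +-distrib-/; m<n⇒m%n≡m; m<n⇒m/n≡0; m/n≤m; m*n/n≡m; 0/n≡0)
open import Data.Nat.Primality using (Prime; prime⇒nonZero; prime⇒nonTrivial; euclidsLemma)
import Data.Nat.Properties as ℕ
open import Data.Nat.Solver using () renaming (module +-*-Solver to ℕ-Solver)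
open import Data.Product using (_,_)
open import Data.Rational as ℚ using (ℚ; 0ℚ; 1ℚ; _+_; _-_; _*_; -_; toℚᵘ)
open import Data.Rational.Properties
  using ( toℚᵘ-injective; toℚᵘ-fromℚᵘ; toℚᵘ-homo-+; toℚᵘ-homo-*; ↧-/; ↧-neg; +-inverseʳ
        ; *-assoc; *-comm; *-identityˡ; *-identityʳ; *-zeroˡ; *-zeroʳ; *-distribˡ-+; *-distribʳ-+)
open import Data.Rational.Solver using () renaming (module +-*-Solver to ℚ-Solver)
import Data.Rational.Unnormalised as ℚᵘ
import Data.Rational.Unnormalised.Properties as ℚᵘ
open import Data.Sum using ([_,_])
open import Function using (case_of_)
open import Relation.Binary.PropositionalEquality hiding ([_])
open import Relation.Nullary using (¬_; yes; no)

ℤtoℚ : ℤ → ℚ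
ℤtoℚ i = i ℚ./ 1

private
  toℚᵘ-ℤtoℚ : ∀ i → toℚᵘ (ℤtoℚ i) ℚᵘ.≃ ℚᵘ.mkℚᵘ i 0
  toℚᵘ-ℤtoℚ i = toℚᵘ-fromℚᵘ (ℚᵘ.mkℚᵘ i 0)

ℤtoℚ-+ : ∀ i j → ℤtoℚ (i ℤ.+ j) ≡ ℤtoℚ i + ℤtoℚ j
ℤtoℚ-+ i j = toℚᵘ-injective (begin
  toℚᵘ (ℤtoℚ (i ℤ.+ j))            ≈⟨ toℚᵘ-ℤtoℚ (i ℤ.+ j) ⟩
  ℚᵘ.mkℚᵘ (i ℤ.+ j) 0               ≈⟨ ℚᵘ.*≡* (solve 2 (λ i j → (i :+ j) :* con (ℤ.+ 1) := (i :* con (ℤ.+ 1) :+ j :* con (ℤ.+ 1)) :* con (ℤ.+ 1)) refl i j) ⟩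
  ℚᵘ.mkℚᵘ i 0 ℚᵘ.+ ℚᵘ.mkℚᵘ j 0     ≈⟨ ℚᵘ.+-cong (toℚᵘ-ℤtoℚ i) (toℚᵘ-ℤtoℚ j) ⟨
  toℚᵘ (ℤtoℚ i) ℚᵘ.+ toℚᵘ (ℤtoℚ j)  ≈⟨ toℚᵘ-homo-+ (ℤtoℚ i) (ℤtoℚ j) ⟨
  toℚᵘ (ℤtoℚ i + ℤtoℚ j)            ∎)
  where open ℚᵘ.≃-Reasoning
        open ℤ-Solver

ℤtoℚ-* : ∀ i j → ℤtoℚ (i ℤ.* j) ≡ ℤtoℚ i * ℤtoℚ j
ℤtoℚ-* i j = toℚᵘ-injective (begin
  toℚᵘ (ℤtoℚ (i ℤ.* j))            ≈⟨ toℚᵘ-ℤtoℚ (i ℤ.* j) ⟩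
  ℚᵘ.mkℚᵘ (i ℤ.* j) 0               ≈⟨ ℚᵘ.*≡* refl ⟩
  ℚᵘ.mkℚᵘ i 0 ℚᵘ.* ℚᵘ.mkℚᵘ j 0     ≈⟨ ℚᵘ.*-cong (toℚᵘ-ℤtoℚ i) (toℚᵘ-ℤtoℚ j) ⟨
  toℚᵘ (ℤtoℚ i) ℚᵘ.* toℚᵘ (ℤtoℚ j)  ≈⟨ toℚᵘ-homo-* (ℤtoℚ i) (ℤtoℚ j) ⟨
  toℚᵘ (ℤtoℚ i * ℤtoℚ j)            ∎)
  where open ℚᵘ.≃-Reasoning

ℕtoℚ-+ : ∀ a b → ℕtoℚ (a ℕ.+ b) ≡ ℕtoℚ a + ℕtoℚ b
ℕtoℚ-+ a b = trans (cong ℤtoℚ (ℤ.pos-+ a b)) (ℤtoℚ-+ (ℤ.+ a) (ℤ.+ b))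

ℕtoℚ-* : ∀ a b → ℕtoℚ (a ℕ.* b) ≡ ℕtoℚ a * ℕtoℚ b
ℕtoℚ-* a b = trans (cong ℤtoℚ (ℤ.pos-* a b)) (ℤtoℚ-* (ℤ.+ a) (ℤ.+ b))

ℕtoℚ-suc : ∀ a → ℕtoℚ (suc a) ≡ 1ℚ + ℕtoℚ a
ℕtoℚ-suc = ℕtoℚ-+ 1

1/suc : ℕ → ℚ
1/suc k = ℤ.+ 1 ℚ./ suc k

ℕtoℚ-suc*1/suc : ∀ k → ℕtoℚ (suc k) * 1/suc k ≡ 1ℚ
ℕtoℚ-suc*1/suc k = toℚᵘ-injective (begin
  toℚᵘ (ℕtoℚ (suc k) * 1/suc k)             ≈⟨ toℚᵘ-homo-* (ℕtoℚ (suc k)) (1/suc k) ⟩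
  toℚᵘ (ℕtoℚ (suc k)) ℚᵘ.* toℚᵘ (1/suc k)   ≈⟨ ℚᵘ.*-cong (toℚᵘ-ℤtoℚ (ℤ.+ suc k)) (toℚᵘ-fromℚᵘ (ℚᵘ.mkℚᵘ (ℤ.+ 1) k)) ⟩
  ℚᵘ.mkℚᵘ (ℤ.+ suc k) 0 ℚᵘ.* ℚᵘ.mkℚᵘ (ℤ.+ 1) k  ≈⟨ ℚᵘ.*-inverseʳ (ℚᵘ.mkℚᵘ (ℤ.+ suc k) 0) ⟩
  ℚᵘ.1ℚᵘ                                    ∎)
  where open ℚᵘ.≃-Reasoning

↧ₙ-/-∣ : ∀ i n .{{_ : ℕ.NonZero n}} → ℚ.↧ₙ (i ℚ./ n) ∣ n
↧ₙ-/-∣ i n = divides ℤ.∣ gcdℤ i (ℤ.+ n) ∣ (begin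
  n                                         ≡⟨ cong ℤ.∣_∣ (↧-/ i n) ⟨
  ℤ.∣ ℚ.↧ (i ℚ./ n) ℤ.* gcdℤ i (ℤ.+ n) ∣       ≡⟨ ℤ.abs-* (ℚ.↧ (i ℚ./ n)) (gcdℤ i (ℤ.+ n)) ⟩
  ℚ.↧ₙ (i ℚ./ n) ℕ.* ℤ.∣ gcdℤ i (ℤ.+ n) ∣      ≡⟨ ℕ.*-comm (ℚ.↧ₙ (i ℚ./ n)) _ ⟩
  ℤ.∣ gcdℤ i (ℤ.+ n) ∣ ℕ.* ℚ.↧ₙ (i ℚ./ n)      ∎)
  where open ≡-Reasoning

module _ {p : ℕ} (pp : Prime p) where

  private
    ∤-* : ∀ {a b} → ¬ p ∣ a → ¬ p ∣ b → ¬ p ∣ a ℕ.* b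
    ∤-* {a} {b} p∤a p∤b p∣ab = [ p∤a , p∤b ] (euclidsLemma a b pp p∣ab)

  /-isPIntegral : ∀ i n .{{_ : ℕ.NonZero n}} → ¬ p ∣ n → IsPIntegral p (i ℚ./ n)
  /-isPIntegral i n p∤n p∣den = p∤n (∣-trans p∣den (↧ₙ-/-∣ i n))

  ℤtoℚ-isPIntegral : ∀ i → IsPIntegral p (ℤtoℚ i)
  ℤtoℚ-isPIntegral i = /-isPIntegral i 1 (λ p∣1 → ℕ.nonTrivial⇒≢1 {{prime⇒nonTrivial pp}} (∣1⇒≡1 p∣1))

  ℕtoℚ-isPIntegral : ∀ n → IsPIntegral p (ℕtoℚ n)
  ℕtoℚ-isPIntegral n = ℤtoℚ-isPIntegral (ℤ.+ n)

  1/suc-isPIntegral : ∀ k → ¬ p ∣ suc k → IsPIntegral p (1/suc k)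
  1/suc-isPIntegral k = /-isPIntegral (ℤ.+ 1) (suc k)

  +-isPIntegral : ∀ x y → IsPIntegral p x → IsPIntegral p y → IsPIntegral p (x + y)
  +-isPIntegral x@record{} y@record{} px py =
    /-isPIntegral (ℚ.↥ x ℤ.* ℚ.↧ y ℤ.+ ℚ.↥ y ℤ.* ℚ.↧ x) (ℚ.↧ₙ x ℕ.* ℚ.↧ₙ y) (∤-* px py)

  *-isPIntegral : ∀ x y → IsPIntegral p x → IsPIntegral p y → IsPIntegral p (x * y)
  *-isPIntegral x@record{} y@record{} px py =
    /-isPIntegral (ℚ.↥ x ℤ.* ℚ.↥ y) (ℚ.↧ₙ x ℕ.* ℚ.↧ₙ y) (∤-* px py)

  neg-isPIntegral : ∀ x → IsPIntegral p x → IsPIntegral p (- x)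
  neg-isPIntegral x = subst (λ d → ¬ p ∣ d) (cong ℤ.∣_∣ (sym (↧-neg x)))

  sub-isPIntegral : ∀ x y → IsPIntegral p x → IsPIntegral p y → IsPIntegral p (x - y)
  sub-isPIntegral x y px py = +-isPIntegral x (- y) px (neg-isPIntegral y py)

-- A record rather than Defs' Σ-type, so that x and y can be inferred from a proof.
infix 4 _≡_[mod_·ℤ₍_₎]
record _≡_[mod_·ℤ₍_₎] (x y q : ℚ) (p : ℕ) : Set where
  constructor multiple
  field
    quotient          : ℚ
    quotient-integral : IsPIntegral p quotient
    difference        : x - y ≡ q * quotient

≡-mod⇒≡[mod^] : ∀ {x y p m} → x ≡ y [mod ℕtoℚ (p ^ m) ·ℤ₍ p ₎] → x ≡ y [mod p ^ m ]
≡-mod⇒≡[mod^] (multiple t pt x-y≡qt) = t , pt , x-y≡qt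

module _ {p : ℕ} (pp : Prime p) {q : ℚ} where

  ≡⇒≡-mod : ∀ {x y} → x ≡ y → x ≡ y [mod q ·ℤ₍ p ₎]
  ≡⇒≡-mod {x} refl = multiple 0ℚ (ℤtoℚ-isPIntegral pp (ℤ.+ 0)) (trans (+-inverseʳ x) (sym (*-zeroʳ q)))

  ≡-mod-trans : ∀ {x y z} → x ≡ y [mod q ·ℤ₍ p ₎] → y ≡ z [mod q ·ℤ₍ p ₎] → x ≡ z [mod q ·ℤ₍ p ₎]
  ≡-mod-trans {x} {y} {z} (multiple s ps x-y≡qs) (multiple t pt y-z≡qt) =
    multiple (s + t) (+-isPIntegral pp s t ps pt) (begin
      x - z             ≡⟨ solve 3 (λ x y z → x :- z := (x :- y) :+ (y :- z)) refl x y z ⟩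
      (x - y) + (y - z) ≡⟨ cong₂ _+_ x-y≡qs y-z≡qt ⟩
      q * s + q * t     ≡⟨ *-distribˡ-+ q s t ⟨
      q * (s + t)       ∎)
    where open ≡-Reasoning
          open ℚ-Solver

  ≡-mod-*ʳ : ∀ {x y} (c : ℚ) → IsPIntegral p c → x ≡ y [mod q ·ℤ₍ p ₎] → x * c ≡ y * c [mod q ·ℤ₍ p ₎]
  ≡-mod-*ʳ {x} {y} c pc (multiple t pt x-y≡qt) = multiple (t * c) (*-isPIntegral pp t c pt pc) (begin
    x * c - y * c ≡⟨ solve 3 (λ x y c → x :* c :- y :* c := (x :- y) :* c) refl x y c ⟩
    (x - y) * c   ≡⟨ cong (_* c) x-y≡qt ⟩
    q * t * c     ≡⟨ *-assoc q t c ⟩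
    q * (t * c)   ∎)
    where open ≡-Reasoning
          open ℚ-Solver

  ≡-mod-divisor : ∀ {x y} q′ r → q ≡ q′ * r → IsPIntegral p r → x ≡ y [mod q ·ℤ₍ p ₎] → x ≡ y [mod q′ ·ℤ₍ p ₎]
  ≡-mod-divisor q′ r q≡q′r pr (multiple t pt x-y≡qt) =
    multiple (r * t) (*-isPIntegral pp r t pr pt) (trans x-y≡qt (trans (cong (_* t) q≡q′r) (*-assoc q′ r t)))

C-absorb : ∀ m k → ℕtoℚ (m C suc k) * ℕtoℚ (suc k) ≡ ℕtoℚ (m C k) * (ℕtoℚ m - ℕtoℚ k)
C-absorb zero    zero    = refl
C-absorb zero    (suc k) = trans (*-zeroˡ (ℕtoℚ (suc (suc k)))) (sym (*-zeroˡ (0ℚ - ℕtoℚ (suc k))))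
C-absorb (suc m) zero    = begin
  ℕtoℚ (suc m C 1) * 1ℚ    ≡⟨ cong (λ c → ℕtoℚ c * 1ℚ) (nC1≡n (suc m)) ⟩
  ℕtoℚ (suc m) * 1ℚ        ≡⟨ solve 1 (λ x → x :* con 1ℚ := con 1ℚ :* (x :- con 0ℚ)) refl (ℕtoℚ (suc m)) ⟩
  1ℚ * (ℕtoℚ (suc m) - 0ℚ) ∎
  where open ≡-Reasoning
        open ℚ-Solver
C-absorb (suc m) (suc k) = begin
  ℕtoℚ (suc m C suc (suc k)) * k+2     ≡⟨ cong (_* k+2) (pascal (suc k)) ⟩
  (b + c) * k+2                        ≡⟨ *-distribʳ-+ k+2 b c ⟩
  b * k+2 + c * k+2                    ≡⟨ cong (b * k+2 +_) (C-absorb m (suc k)) ⟩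
  b * k+2 + b * (x - k+1)              ≡⟨ cong₂ (λ s t → b * s + b * (x - t)) k+2≡2+y k+1≡1+y ⟩
  b * (1ℚ + (1ℚ + y)) + b * (x - (1ℚ + y))
    ≡⟨ solve 3 (λ b x y → b :* (con 1ℚ :+ (con 1ℚ :+ y)) :+ b :* (x :- (con 1ℚ :+ y))
                          := b :* (con 1ℚ :+ y) :+ b :* (x :- y)) refl b x y ⟩
  b * (1ℚ + y) + b * (x - y)           ≡⟨ cong (λ t → b * t + b * (x - y)) k+1≡1+y ⟨
  b * k+1 + b * (x - y)                ≡⟨ cong (_+ b * (x - y)) (C-absorb m k) ⟩
  a * (x - y) + b * (x - y)
    ≡⟨ solve 4 (λ a b x y → a :* (x :- y) :+ b :* (x :- y) := (a :+ b) :* ((con 1ℚ :+ x) :- (con 1ℚ :+ y))) refl a b x y ⟩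
  (a + b) * ((1ℚ + x) - (1ℚ + y))      ≡⟨ cong₂ _*_ (pascal k) (cong₂ _-_ (ℕtoℚ-suc m) k+1≡1+y) ⟨
  ℕtoℚ (suc m C suc k) * (ℕtoℚ (suc m) - k+1) ∎
  where
  open ≡-Reasoning
  open ℚ-Solver
  a = ℕtoℚ (m C k)
  b = ℕtoℚ (m C suc k)
  c = ℕtoℚ (m C suc (suc k))
  x = ℕtoℚ m
  y = ℕtoℚ k
  k+1 = ℕtoℚ (suc k)
  k+2 = ℕtoℚ (suc (suc k))
  k+1≡1+y : k+1 ≡ 1ℚ + y
  k+1≡1+y = ℕtoℚ-suc k
  k+2≡2+y : k+2 ≡ 1ℚ + (1ℚ + y)
  k+2≡2+y = trans (ℕtoℚ-suc (suc k)) (cong (λ z → 1ℚ + z) k+1≡1+y)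
  pascal : ∀ j → ℕtoℚ (suc m C suc j) ≡ ℕtoℚ (m C j) + ℕtoℚ (m C suc j)
  pascal j = trans (cong ℕtoℚ (sym (nCk+nC[k+1]≡[n+1]C[k+1] m j))) (ℕtoℚ-+ (m C j) (m C suc j))

ratio : ℕ → ℕ → ℚ
ratio L k = (ℕtoℚ L - ℕtoℚ (suc k)) * 1/suc k

ratio≡ : ∀ L k → ratio L k ≡ ℕtoℚ L * 1/suc k - 1ℚ
ratio≡ L k = begin
  (ℕtoℚ L - ℕtoℚ (suc k)) * 1/suc k          ≡⟨ solve 3 (λ l s u → (l :- s) :* u := l :* u :- s :* u) refl (ℕtoℚ L) (ℕtoℚ (suc k)) (1/suc k) ⟩
  ℕtoℚ L * 1/suc k - ℕtoℚ (suc k) * 1/suc k  ≡⟨ cong (λ z → ℕtoℚ L * 1/suc k - z) (ℕtoℚ-suc*1/suc k) ⟩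
  ℕtoℚ L * 1/suc k - 1ℚ                       ∎
  where open ≡-Reasoning
        open ℚ-Solver

ratio-isPIntegral : ∀ {p} → Prime p → ∀ L k → ¬ p ∣ suc k → IsPIntegral p (ratio L k)
ratio-isPIntegral pp L k p∤k+1 = subst (IsPIntegral _) (sym (ratio≡ L k))
  (sub-isPIntegral pp (ℕtoℚ L * 1/suc k) 1ℚ (*-isPIntegral pp (ℕtoℚ L) (1/suc k) (ℕtoℚ-isPIntegral pp L) (1/suc-isPIntegral pp k p∤k+1))
                          (ℕtoℚ-isPIntegral pp 1))

*-inverse-unique : ∀ a b c → a * b ≡ 1ℚ → a * c ≡ 1ℚ → b ≡ c
*-inverse-unique a b c ab≡1 ac≡1 = begin
  b             ≡⟨ *-identityʳ b ⟨
  b * 1ℚ        ≡⟨ cong (b *_) ac≡1 ⟨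
  b * (a * c)   ≡⟨ solve 3 (λ a b c → b :* (a :* c) := (a :* b) :* c) refl a b c ⟩
  (a * b) * c   ≡⟨ cong (_* c) ab≡1 ⟩
  1ℚ * c        ≡⟨ *-identityˡ c ⟩
  c             ∎
  where open ≡-Reasoning
        open ℚ-Solver

ratio-cancel : ∀ d M i k → suc k ≡ suc i ℕ.* d → ratio (d ℕ.* M) k ≡ ratio M i
ratio-cancel d M i k k+1≡[i+1]d = begin
  ratio (d ℕ.* M) k                ≡⟨ ratio≡ (d ℕ.* M) k ⟩
  ℕtoℚ (d ℕ.* M) * 1/suc k - 1ℚ    ≡⟨ cong (λ z → z * 1/suc k - 1ℚ) (ℕtoℚ-* d M) ⟩
  ℕtoℚ d * ℕtoℚ M * 1/suc k - 1ℚ   ≡⟨ cong (_- 1ℚ) (solve 3 (λ d m u → d :* m :* u := m :* (d :* u)) refl (ℕtoℚ d) (ℕtoℚ M) (1/suc k)) ⟩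
  ℕtoℚ M * (ℕtoℚ d * 1/suc k) - 1ℚ ≡⟨ cong (λ z → ℕtoℚ M * z - 1ℚ) d/[k+1]≡1/[i+1] ⟩
  ℕtoℚ M * 1/suc i - 1ℚ            ≡⟨ ratio≡ M i ⟨
  ratio M i                        ∎
  where
  open ≡-Reasoning
  open ℚ-Solver
  d/[k+1]≡1/[i+1] : ℕtoℚ d * 1/suc k ≡ 1/suc i
  d/[k+1]≡1/[i+1] = *-inverse-unique (ℕtoℚ (suc i)) (ℕtoℚ d * 1/suc k) (1/suc i) (begin
    ℕtoℚ (suc i) * (ℕtoℚ d * 1/suc k)  ≡⟨ *-assoc (ℕtoℚ (suc i)) (ℕtoℚ d) (1/suc k) ⟨
    ℕtoℚ (suc i) * ℕtoℚ d * 1/suc k    ≡⟨ cong (_* 1/suc k) (trans (cong ℕtoℚ k+1≡[i+1]d) (ℕtoℚ-* (suc i) d)) ⟨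
    ℕtoℚ (suc k) * 1/suc k             ≡⟨ ℕtoℚ-suc*1/suc k ⟩
    1ℚ                                 ∎) (ℕtoℚ-suc*1/suc i)

C-suc : ∀ L .{{_ : ℕ.NonZero L}} k → ℕtoℚ ((L ∸ 1) C suc k) ≡ ℕtoℚ ((L ∸ 1) C k) * ratio L k
C-suc (suc m) k = begin
  ℕtoℚ (m C suc k)                          ≡⟨ *-identityʳ (ℕtoℚ (m C suc k)) ⟨
  ℕtoℚ (m C suc k) * 1ℚ                     ≡⟨ cong (ℕtoℚ (m C suc k) *_) (ℕtoℚ-suc*1/suc k) ⟨
  ℕtoℚ (m C suc k) * (ℕtoℚ (suc k) * 1/suc k) ≡⟨ *-assoc (ℕtoℚ (m C suc k)) (ℕtoℚ (suc k)) (1/suc k) ⟨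
  ℕtoℚ (m C suc k) * ℕtoℚ (suc k) * 1/suc k  ≡⟨ cong (_* 1/suc k) (C-absorb m k) ⟩
  ℕtoℚ (m C k) * (ℕtoℚ m - ℕtoℚ k) * 1/suc k ≡⟨ cong (λ z → ℕtoℚ (m C k) * z * 1/suc k) m-k≡[m+1]-[k+1] ⟩
  ℕtoℚ (m C k) * (ℕtoℚ (suc m) - ℕtoℚ (suc k)) * 1/suc k ≡⟨ *-assoc (ℕtoℚ (m C k)) (ℕtoℚ (suc m) - ℕtoℚ (suc k)) (1/suc k) ⟩
  ℕtoℚ (m C k) * ratio (suc m) k            ∎
  where
  open ≡-Reasoning
  open ℚ-Solver
  m-k≡[m+1]-[k+1] : ℕtoℚ m - ℕtoℚ k ≡ ℕtoℚ (suc m) - ℕtoℚ (suc k)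
  m-k≡[m+1]-[k+1] = trans (solve 2 (λ x y → x :- y := (con 1ℚ :+ x) :- (con 1ℚ :+ y)) refl (ℕtoℚ m) (ℕtoℚ k))
                          (sym (cong₂ _-_ (ℕtoℚ-suc m) (ℕtoℚ-suc k)))

sign : ℕ → ℚ
sign e = ℤtoℚ (-1ℤ ℤ.^ e)

sign-suc : ∀ e → sign (suc e) ≡ - sign e
sign-suc e = begin
  ℤtoℚ (-1ℤ ℤ.* -1ℤ ℤ.^ e)   ≡⟨ ℤtoℚ-* -1ℤ (-1ℤ ℤ.^ e) ⟩
  ℤtoℚ -1ℤ * sign e          ≡⟨ solve 1 (λ s → con (ℤtoℚ -1ℤ) :* s := :- s) refl (sign e) ⟩
  - sign e                   ∎
  where open ≡-Reasoning
        open ℚ-Solver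

module _ {p : ℕ} .{{_ : ℕ.NonZero p}} where

  ∣suc⇒suc≡[1+/]* : ∀ k → p ∣ suc k → suc k ≡ suc (k / p) ℕ.* p
  ∣suc⇒suc≡[1+/]* k p∣k+1 = begin
    suc k                            ≡⟨ cong suc (m≡m%n+[m/n]*n k p) ⟩
    suc (k % p) ℕ.+ k / p ℕ.* p      ≡⟨ cong (λ r → suc r ℕ.+ k / p ℕ.* p) (%-pred-≡0 (n∣m⇒m%n≡0 (suc k) p p∣k+1)) ⟩
    suc (p ∸ 1) ℕ.+ k / p ℕ.* p      ≡⟨ cong (ℕ._+ k / p ℕ.* p) (ℕ.suc-pred p) ⟩
    suc (k / p) ℕ.* p                ∎
    where open ≡-Reasoning

  ∣suc⇒/-suc : ∀ k → p ∣ suc k → suc k / p ≡ suc (k / p)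
  ∣suc⇒/-suc k p∣k+1 = trans (cong (_/ p) (∣suc⇒suc≡[1+/]* k p∣k+1)) (m*n/n≡m (suc (k / p)) p)

  ∤suc⇒/-suc : 1 ℕ.< p → ∀ k → ¬ p ∣ suc k → suc k / p ≡ k / p
  ∤suc⇒/-suc 1<p k p∤k+1 = begin
    (1 ℕ.+ k) / p      ≡⟨ +-distrib-/ 1 k 1%p+k%p<p ⟩
    1 / p ℕ.+ k / p    ≡⟨ cong (ℕ._+ k / p) (m<n⇒m/n≡0 1<p) ⟩
    k / p              ∎
    where
    open ≡-Reasoning
    1+k%p<p : suc (k % p) ℕ.< p
    1+k%p<p = ℕ.≤∧≢⇒< (m%n<n k p) λ 1+k%p≡p →
      p∤k+1 (divides (suc (k / p)) (trans (cong suc (m≡m%n+[m/n]*n k p)) (cong (ℕ._+ k / p ℕ.* p) 1+k%p≡p)))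
    1%p+k%p<p : 1 % p ℕ.+ k % p ℕ.< p
    1%p+k%p<p = subst (λ r → r ℕ.+ k % p ℕ.< p) (sym (m<n⇒m%n≡m 1<p)) 1+k%p<p

productPrimeTo : ℕ → ℕ → ℕ → ℚ
productPrimeTo p L zero = 1ℚ
productPrimeTo p L (suc k) with p ∣? suc k
... | yes _ = productPrimeTo p L k
... | no  _ = productPrimeTo p L k * ratio L k

productPrimeTo-∣ : ∀ {p L k} → p ∣ suc k → productPrimeTo p L (suc k) ≡ productPrimeTo p L k
productPrimeTo-∣ {p} {L} {k} p∣k+1 with p ∣? suc k
... | yes _    = refl
... | no p∤k+1 = ⊥-elim (p∤k+1 p∣k+1)

productPrimeTo-∤ : ∀ {p L k} → ¬ p ∣ suc k → productPrimeTo p L (suc k) ≡ productPrimeTo p L k * ratio L k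
productPrimeTo-∤ {p} {L} {k} p∤k+1 with p ∣? suc k
... | yes p∣k+1 = ⊥-elim (p∤k+1 p∣k+1)
... | no _      = refl

harmonicPrimeTo-∣ : ∀ {p k} → p ∣ suc k → harmonicPrimeTo p (suc k) ≡ harmonicPrimeTo p k
harmonicPrimeTo-∣ {p} {k} p∣k+1 with p ∣? suc k
... | yes _    = refl
... | no p∤k+1 = ⊥-elim (p∤k+1 p∣k+1)

harmonicPrimeTo-∤ : ∀ {p k} → ¬ p ∣ suc k → harmonicPrimeTo p (suc k) ≡ harmonicPrimeTo p k + 1/suc k
harmonicPrimeTo-∤ {p} {k} p∤k+1 with p ∣? suc k
... | yes p∣k+1 = ⊥-elim (p∤k+1 p∣k+1)
... | no _      = refl

module _ {p : ℕ} (pp : Prime p) where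

  private
    instance
      p≢0 : ℕ.NonZero p
      p≢0 = prime⇒nonZero pp

    1<p : 1 ℕ.< p
    1<p = ℕ.nonTrivial⇒n>1 p {{prime⇒nonTrivial pp}}

  productPrimeTo-factorization : ∀ {N M} .{{_ : ℕ.NonZero N}} .{{_ : ℕ.NonZero M}} → N ≡ p ℕ.* M → ∀ k →
    ℕtoℚ ((N ∸ 1) C k) ≡ ℕtoℚ ((M ∸ 1) C (k / p)) * productPrimeTo p N k
  productPrimeTo-factorization {N} {M} N≡pM zero =
    sym (trans (cong (λ e → ℕtoℚ ((M ∸ 1) C e) * 1ℚ) (0/n≡0 p)) (*-identityʳ 1ℚ))
  productPrimeTo-factorization {N} {M} N≡pM (suc k) = case p ∣? suc k of λ where
      (no p∤k+1) → begin
        ℕtoℚ ((N ∸ 1) C suc k)            ≡⟨ C-suc N k ⟩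
        ℕtoℚ ((N ∸ 1) C k) * ratio N k    ≡⟨ cong (_* ratio N k) ih ⟩
        B (k / p) * P k * ratio N k       ≡⟨ *-assoc (B (k / p)) (P k) (ratio N k) ⟩
        B (k / p) * (P k * ratio N k)     ≡⟨ cong₂ (λ i Q → B i * Q) (∤suc⇒/-suc 1<p k p∤k+1) (productPrimeTo-∤ p∤k+1) ⟨
        B (suc k / p) * P (suc k)         ∎
      (yes p∣k+1) → let i = k / p in begin
        ℕtoℚ ((N ∸ 1) C suc k)            ≡⟨ C-suc N k ⟩
        ℕtoℚ ((N ∸ 1) C k) * ratio N k    ≡⟨ cong (_* ratio N k) ih ⟩
        B i * P k * ratio N k             ≡⟨ cong (λ L → B i * P k * ratio L k) N≡pM ⟩
        B i * P k * ratio (p ℕ.* M) k     ≡⟨ cong (B i * P k *_) (ratio-cancel p M i k (∣suc⇒suc≡[1+/]* k p∣k+1)) ⟩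
        B i * P k * ratio M i             ≡⟨ solve 3 (λ b q r → b :* q :* r := b :* r :* q) refl (B i) (P k) (ratio M i) ⟩
        B i * ratio M i * P k             ≡⟨ cong (_* P k) (C-suc M i) ⟨
        B (suc i) * P k                   ≡⟨ cong₂ (λ j Q → B j * Q) (∣suc⇒/-suc k p∣k+1) (productPrimeTo-∣ p∣k+1) ⟨
        B (suc k / p) * P (suc k)         ∎
    where
    open ≡-Reasoning
    open ℚ-Solver
    ih : ℕtoℚ ((N ∸ 1) C k) ≡ ℕtoℚ ((M ∸ 1) C (k / p)) * productPrimeTo p N k
    ih = productPrimeTo-factorization N≡pM k
    B : ℕ → ℚ
    B i = ℕtoℚ ((M ∸ 1) C i)
    P : ℕ → ℚ
    P = productPrimeTo p N

  harmonicPrimeTo-isPIntegral : ∀ k → IsPIntegral p (harmonicPrimeTo p k)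
  harmonicPrimeTo-isPIntegral zero    = ℤtoℚ-isPIntegral pp (ℤ.+ 0)
  harmonicPrimeTo-isPIntegral (suc k) = case p ∣? suc k of λ where
      (yes p∣k+1) → subst (IsPIntegral p) (sym (harmonicPrimeTo-∣ p∣k+1)) ih
      (no p∤k+1)  → subst (IsPIntegral p) (sym (harmonicPrimeTo-∤ p∤k+1))
                      (+-isPIntegral pp (harmonicPrimeTo p k) (1/suc k) ih (1/suc-isPIntegral pp k p∤k+1))
    where ih = harmonicPrimeTo-isPIntegral k

  productPrimeTo-≡-mod : ∀ L k →
    productPrimeTo p L k ≡ sign (k ∸ k / p) * (1ℚ - ℕtoℚ L * harmonicPrimeTo p k) [mod ℕtoℚ L * ℕtoℚ L ·ℤ₍ p ₎]
  productPrimeTo-≡-mod L zero = ≡⇒≡-mod pp (begin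
    1ℚ                                    ≡⟨ solve 1 (λ l → con 1ℚ := con 1ℚ :* (con 1ℚ :- l :* con 0ℚ)) refl (ℕtoℚ L) ⟩
    1ℚ * (1ℚ - ℕtoℚ L * 0ℚ)               ≡⟨ cong (λ e → sign (0 ∸ e) * (1ℚ - ℕtoℚ L * 0ℚ)) (0/n≡0 p) ⟨
    sign (0 ∸ 0 / p) * (1ℚ - ℕtoℚ L * 0ℚ) ∎)
    where open ≡-Reasoning
          open ℚ-Solver
  productPrimeTo-≡-mod L (suc k) = case p ∣? suc k of λ where
      (yes p∣k+1) → subst₂ (λ P R → P ≡ R [mod l * l ·ℤ₍ p ₎])
                      (sym (productPrimeTo-∣ p∣k+1))
                      (cong₂ (λ e H′ → sign e * (1ℚ - l * H′)) (sym (cong (suc k ∸_) (∣suc⇒/-suc k p∣k+1))) (sym (harmonicPrimeTo-∣ p∣k+1)))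
                      ih
      (no p∤k+1) → subst (λ P → P ≡ sign (suc k ∸ suc k / p) * (1ℚ - l * harmonicPrimeTo p (suc k)) [mod l * l ·ℤ₍ p ₎])
                     (sym (productPrimeTo-∤ p∤k+1))
                     (≡-mod-trans pp (≡-mod-*ʳ pp (ratio L k) (ratio-isPIntegral pp L k p∤k+1) ih) (next p∤k+1))
    where
    open ≡-Reasoning
    open ℚ-Solver
    l = ℕtoℚ L
    H = harmonicPrimeTo p k
    σ = sign (k ∸ k / p)
    u = 1/suc k
    ih : productPrimeTo p L k ≡ σ * (1ℚ - l * H) [mod l * l ·ℤ₍ p ₎]
    ih = productPrimeTo-≡-mod L k
    next : ¬ p ∣ suc k →
      σ * (1ℚ - l * H) * ratio L k ≡ sign (suc k ∸ suc k / p) * (1ℚ - l * harmonicPrimeTo p (suc k)) [mod l * l ·ℤ₍ p ₎]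
    next p∤k+1 = multiple (- (σ * H * u)) σHu-isPIntegral (begin
      σ * (1ℚ - l * H) * ratio L k - sign (suc k ∸ suc k / p) * (1ℚ - l * harmonicPrimeTo p (suc k))
        ≡⟨ cong₂ (λ r R → σ * (1ℚ - l * H) * r - R) (ratio≡ L k)
                 (cong₂ (λ s H′ → s * (1ℚ - l * H′)) sign-flips (harmonicPrimeTo-∤ p∤k+1)) ⟩
      σ * (1ℚ - l * H) * (l * u - 1ℚ) - (- σ) * (1ℚ - l * (H + u))
        ≡⟨ solve 4 (λ σ l H u → σ :* (con 1ℚ :- l :* H) :* (l :* u :- con 1ℚ) :- (:- σ) :* (con 1ℚ :- l :* (H :+ u))
                                := l :* l :* (:- (σ :* H :* u))) refl σ l H u ⟩
      l * l * (- (σ * H * u)) ∎)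
      where
      sign-flips : sign (suc k ∸ suc k / p) ≡ - σ
      sign-flips = begin
        sign (suc k ∸ suc k / p)  ≡⟨ cong (λ i → sign (suc k ∸ i)) (∤suc⇒/-suc 1<p k p∤k+1) ⟩
        sign (suc k ∸ k / p)      ≡⟨ cong sign (ℕ.+-∸-assoc 1 (m/n≤m k p)) ⟩
        sign (suc (k ∸ k / p))    ≡⟨ sign-suc (k ∸ k / p) ⟩
        - σ                       ∎
      σHu-isPIntegral : IsPIntegral p (- (σ * H * u))
      σHu-isPIntegral = neg-isPIntegral pp (σ * H * u)
        (*-isPIntegral pp (σ * H) u (*-isPIntegral pp σ H (ℤtoℚ-isPIntegral pp (-1ℤ ℤ.^ (k ∸ k / p))) (harmonicPrimeTo-isPIntegral k))
                                   (1/suc-isPIntegral pp k p∤k+1))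

  binomial-≡-mod : ∀ {N M} .{{_ : ℕ.NonZero N}} .{{_ : ℕ.NonZero M}} → N ≡ p ℕ.* M → ∀ k →
    ℕtoℚ ((N ∸ 1) C k) ≡ ℕtoℚ ((M ∸ 1) C (k / p)) * sign (k ∸ k / p) * (1ℚ - ℕtoℚ N * harmonicPrimeTo p k)
      [mod ℕtoℚ N * ℕtoℚ N ·ℤ₍ p ₎]
  binomial-≡-mod {N} {M} N≡pM k = subst₂ (λ x y → x ≡ y [mod ℕtoℚ N * ℕtoℚ N ·ℤ₍ p ₎])
    (trans (*-comm P B) (sym (productPrimeTo-factorization N≡pM k)))
    (solve 3 (λ s h b → s :* h :* b := b :* s :* h) refl σ (1ℚ - ℕtoℚ N * harmonicPrimeTo p k) B)
    (≡-mod-*ʳ pp B (ℕtoℚ-isPIntegral pp ((M ∸ 1) C (k / p))) (productPrimeTo-≡-mod N k))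
    where
    open ℚ-Solver
    B = ℕtoℚ ((M ∸ 1) C (k / p))
    P = productPrimeTo p N k
    σ = sign (k ∸ k / p)

ℕtoℚ-[p^α*n]² : ∀ p α n → ℕtoℚ (p ^ α ℕ.* n) * ℕtoℚ (p ^ α ℕ.* n) ≡ ℕtoℚ (p ^ (2 ℕ.* α)) * (ℕtoℚ n * ℕtoℚ n)
ℕtoℚ-[p^α*n]² p α n = begin
  ℕtoℚ N * ℕtoℚ N                               ≡⟨ ℕtoℚ-* N N ⟨
  ℕtoℚ (N ℕ.* N)                                ≡⟨ cong ℕtoℚ N*N≡p^2α*n*n ⟩
  ℕtoℚ (p ^ (2 ℕ.* α) ℕ.* (n ℕ.* n))            ≡⟨ ℕtoℚ-* (p ^ (2 ℕ.* α)) (n ℕ.* n) ⟩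
  ℕtoℚ (p ^ (2 ℕ.* α)) * ℕtoℚ (n ℕ.* n)         ≡⟨ cong (ℕtoℚ (p ^ (2 ℕ.* α)) *_) (ℕtoℚ-* n n) ⟩
  ℕtoℚ (p ^ (2 ℕ.* α)) * (ℕtoℚ n * ℕtoℚ n)      ∎
  where
  open ≡-Reasoning
  N = p ^ α ℕ.* n
  N*N≡p^2α*n*n : N ℕ.* N ≡ p ^ (2 ℕ.* α) ℕ.* (n ℕ.* n)
  N*N≡p^2α*n*n = begin
    N ℕ.* N                              ≡⟨ solve 2 (λ q n → q :* n :* (q :* n) := q :* q :* (n :* n)) refl (p ^ α) n ⟩
    p ^ α ℕ.* p ^ α ℕ.* (n ℕ.* n)        ≡⟨ cong (ℕ._* (n ℕ.* n)) (ℕ.^-distribˡ-+-* p α α) ⟨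
    p ^ (α ℕ.+ α) ℕ.* (n ℕ.* n)          ≡⟨ cong (λ e → p ^ (α ℕ.+ e) ℕ.* (n ℕ.* n)) (ℕ.+-identityʳ α) ⟨
    p ^ (2 ℕ.* α) ℕ.* (n ℕ.* n)          ∎
    where open ℕ-Solver

lemma2p1 : (n k α p : ℕ) → 1 ≤ n → 1 ≤ k → 1 ≤ α → (pp : Prime p) →
    ℕtoℚ ((p ^ α ℕ.* n ∸ 1) C k)
      ≡ ℕtoℚ ((p ^ (α ∸ 1) ℕ.* n ∸ 1) C (ℕ._/_ k p {{prime⇒nonZero pp}}))
        * ((-1ℤ ℤ.^ (k ∸ ℕ._/_ k p {{prime⇒nonZero pp}})) ℚ./ 1)
        * (1ℚ - ℕtoℚ n * ℕtoℚ (p ^ α) * harmonicPrimeTo p k)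
      [mod p ^ (2 ℕ.* α) ]
lemma2p1 n k zero    p _   _ () pp
lemma2p1 n k (suc a) p 1≤n _ _  pp = ≡-mod⇒≡[mod^] {m = 2 ℕ.* suc a}
  (≡-mod-divisor pp (ℕtoℚ (p ^ (2 ℕ.* suc a))) (ℕtoℚ n * ℕtoℚ n) (ℕtoℚ-[p^α*n]² p (suc a) n) n²-isPIntegral
    (subst (λ x → ℕtoℚ ((N ∸ 1) C k) ≡ B * σ * (1ℚ - x * harmonicPrimeTo p k) [mod ℕtoℚ N * ℕtoℚ N ·ℤ₍ p ₎])
           (trans (ℕtoℚ-* (p ^ suc a) n) (*-comm (ℕtoℚ (p ^ suc a)) (ℕtoℚ n)))
           (binomial-≡-mod pp (ℕ.*-assoc p (p ^ a) n) k)))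
  where
  instance
    p≢0 : ℕ.NonZero p
    p≢0 = prime⇒nonZero pp
    n≢0 : ℕ.NonZero n
    n≢0 = ℕ.>-nonZero 1≤n
    M≢0 : ℕ.NonZero (p ^ a ℕ.* n)
    M≢0 = ℕ.m*n≢0 (p ^ a) n {{ℕ.m^n≢0 p a}}
    N≢0 : ℕ.NonZero (p ^ suc a ℕ.* n)
    N≢0 = ℕ.m*n≢0 (p ^ suc a) n {{ℕ.m^n≢0 p (suc a)}}
  N = p ^ suc a ℕ.* n
  B = ℕtoℚ ((p ^ a ℕ.* n ∸ 1) C (k / p))
  σ = sign (k ∸ k / p)
  n²-isPIntegral : IsPIntegral p (ℕtoℚ n * ℕtoℚ n)
  n²-isPIntegral = *-isPIntegral pp (ℕtoℚ n) (ℕtoℚ n) (ℕtoℚ-isPIntegral pp n) (ℕtoℚ-isPIntegral pp n)
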